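{- Let $G = G^\top \in \mathbb{R}^{N \times N}$ be a real symmetric matrix (an undirected weighted graph on vertex set $\mathbb{V} = \{1,\dots,N\}$) with two cospectral vertices $u,v$. Let $\mathbb{M} \subseteq \mathbb{V}$, let $\gamma = (\gamma_m)_{m \in \mathbb{M}}$ be a tuple of real numbers and $p \in \{+1,-1\}$, and suppose $\mathbb{M}_\gamma^p$ is a walk multiplet of $G$ relative to $u,v$ with parity $p$. Let $H$ be the weighted cone of $G$ over $\mathbb{M}$ with weight tuple $\gamma$, with tip $c = N+1$. Then: (i) $u$ and $v$ are cospectral in $H$; (ii) the tip $c$ is a walk singlet of $H$ relative to $u,v$ with parity $p$, i.e. $[H^k]_{u,c} = p\,[H^k]_{v,c}$ for all integers $k \geq 0$; (iii) every walk multiplet of $G$ relative to $u,v$ with parity $p$ (i.e. every subset $\mathbb{Q} \subseteq \mathbb{V}$ with real weight tuple $\epsilon$ such that $\mathbb{Q}_\epsilon^p$ is a walk multiplet of $G$ relative to $u,v$) is also a walk multiplet of $H$ relative to $u,v$ with the same subset, weight tuple and parity $p$.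
   Context: A real symmetric matrix $H \in \mathbb{R}^{n \times n}$ is identified with an undirected weighted graph on vertices $1,\dots,n$, with edge weight $H_{i,j}$ between $i$ and $j$ (diagonal entries are loops). Two vertices $u,v$ are cospectral in $H$ if $[H^k]_{u,u} = [H^k]_{v,v}$ for all integers $k \geq 0$. Given a subset $\mathbb{M}$ of the vertices, a tuple $\gamma = (\gamma_m)_{m \in \mathbb{M}}$ of real numbers, and $p \in \{+1,-1\}$, $\mathbb{M}$ is called a walk multiplet $\mathbb{M}_\gamma^p$ of $H$ relative to $u,v$ with parity $p$ (even if $p=+1$, odd if $p=-1$) if $\sum_{m \in \mathbb{M}} \gamma_m [H^k]_{u,m} = p \sum_{m \in \mathbb{M}} \gamma_m [H^k]_{v,m}$ for all $k \in \{0,1,\dots,n-1\}$ (equivalently, by Cayley–Hamilton, for all integers $k \geq 0$). A walk singlet relative to $u,v$ with parity $p$ is a single vertex $c$ such that $\{c\}$ (with a nonzero weight) is a walk multiplet with parity $p$, i.e. $[H^k]_{u,c} = p[H^k]_{v,c}$ for all $k \geq 0$. The weighted cone of $G \in \mathbb{R}^{N\times N}$ over $\mathbb{M}$ with weight tuple $\gamma$ is the $(N+1)\times(N+1)$ matrix $H = \begin{bmatrix} G & e_\mathbb{M}^\gamma \\ (e_\mathbb{M}^\gamma)^\top & 0 \end{bmatrix}$, where $e_\mathbb{M}^\gamma \in \mathbb{R}^N$ has entries $\gamma_m$ for $m \in \mathbb{M}$ and $0$ otherwise; the new vertex $N+1$ is the tip. -}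

module Defs where

open import Level using (_⊔_)
open import Data.Nat using (ℕ; zero; suc)
open import Data.Fin using (Fin; zero; suc; inject₁; fromℕ)
open import Data.Fin.Subset using (Subset; _∈_)
open import Data.Maybe using (Maybe; just; nothing)
import Data.Maybe as Maybe
open import Data.Bool using (Bool; true; false)
open import Data.Vec using (lookup; _∷ʳ_)
open import Algebra.Bundles using (CommutativeRing)

data Parity : Set where
  even odd : Parity

-- Classify a vertex of Fin (suc N): `nothing` is the last vertex (the tip, N+1),
-- `just i` is the old vertex i (embedded via inject₁).
classify : ∀ {N} → Fin (suc N) → Maybe (Fin N)
classify {zero}  zero    = nothing
classify {suc N} zero    = just zero
classify {suc N} (suc i) = Maybe.map suc (classify i)

module _ {c ℓ} (R : CommutativeRing c ℓ) where
  open CommutativeRing R renaming (Carrier to A) hiding (zero)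

  Matrix : ℕ → Set c
  Matrix n = Fin n → Fin n → A

  ⟦_⟧ₚ : Parity → A
  ⟦ even ⟧ₚ = 1#
  ⟦ odd  ⟧ₚ = - 1#

  Σ : ∀ {n} → (Fin n → A) → A
  Σ {zero}  f = 0#
  Σ {suc n} f = f zero + Σ (λ i → f (suc i))

  _⊗_ : ∀ {n} → Matrix n → Matrix n → Matrix n
  (M ⊗ P) i j = Σ (λ k → M i k * P k j)

  idM : ∀ {n} → Matrix n
  idM zero    zero    = 1#
  idM zero    (suc j) = 0#
  idM (suc i) zero    = 0#
  idM (suc i) (suc j) = idM i j

  _^ᴹ_ : ∀ {n} → Matrix n → ℕ → Matrix n
  M ^ᴹ zero  = idM
  M ^ᴹ suc k = M ⊗ (M ^ᴹ k)

  Symmetric : ∀ {n} → Matrix n → Set ℓ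
  Symmetric M = ∀ i j → M i j ≈ M j i

  Cospectral : ∀ {n} → Matrix n → Fin n → Fin n → Set ℓ
  Cospectral H u v = ∀ k → (H ^ᴹ k) u u ≈ (H ^ᴹ k) v v

  weightVec : ∀ {n} → Subset n → (Fin n → A) → Fin n → A
  weightVec M γ m with lookup M m
  ... | true  = γ m
  ... | false = 0#

  WalkMultiplet : ∀ {n} → Matrix n → Fin n → Fin n → Subset n → (Fin n → A) → Parity → Set ℓ
  WalkMultiplet H u v M γ p =
    ∀ k → Σ (λ m → weightVec M γ m * (H ^ᴹ k) u m)
          ≈ ⟦ p ⟧ₚ * Σ (λ m → weightVec M γ m * (H ^ᴹ k) v m)

  WalkSinglet : ∀ {n} → Matrix n → Fin n → Fin n → Fin n → Parity → Set ℓ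
  WalkSinglet H u v c p = ∀ k → (H ^ᴹ k) u c ≈ ⟦ p ⟧ₚ * (H ^ᴹ k) v c

  cone : ∀ {N} → Matrix N → Subset N → (Fin N → A) → Matrix (suc N)
  cone G M γ i j with classify i | classify j
  ... | just a  | just b  = G a b
  ... | just a  | nothing = weightVec M γ a
  ... | nothing | just b  = weightVec M γ b
  ... | nothing | nothing = 0#

  liftSubset : ∀ {N} → Subset N → Subset (suc N)
  liftSubset M = M ∷ʳ false

  liftWeights : ∀ {N} → (Fin N → A) → Fin (suc N) → A
  liftWeights γ i with classify i
  ... | just a  = γ a
  ... | nothing = 0#

-- Write d = e_u − p e_v. The vector H^k d vanishes at the tip and agrees with G^k d on the
-- old vertices: one step of the induction multiplies by H, the old rows of H are those of G
-- (the tip contributes nothing, since the tip entry of H^k d is 0), and the tip row of H is the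
-- weight vector γ, whose inner product with G^k d is 0 by the multiplet hypothesis. Reading off
-- this invariant at the tip gives (ii); pairing it with any multiplet weight vector of G gives
-- (iii); and evaluating it at u and v, together with p² = 1 and symmetry, gives (i).
module Submission where

open import Defs
open import Data.Nat using (ℕ; zero; suc)
open import Data.Fin using (Fin; zero; suc; inject₁; fromℕ)
open import Data.Fin.Subset using (Subset)
open import Data.Maybe using (just; nothing)
open import Data.Bool using (true; false)
open import Data.Vec using (Vec; []; _∷_; lookup; _∷ʳ_)
open import Data.Product using (_×_; _,_; proj₁; proj₂)
open import Algebra.Bundles using (CommutativeRing)
open import Relation.Binary.PropositionalEquality as ≡ using (_≡_)

classify-inject₁ : ∀ {N} (a : Fin N) → classify (inject₁ a) ≡ just a
classify-inject₁ {suc N} zero    = ≡.refl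
classify-inject₁ {suc N} (suc a) rewrite classify-inject₁ a = ≡.refl

classify-fromℕ : ∀ N → classify (fromℕ N) ≡ nothing
classify-fromℕ zero    = ≡.refl
classify-fromℕ (suc N) rewrite classify-fromℕ N = ≡.refl

lookup-∷ʳ-inject₁ : ∀ {a} {X : Set a} {n} (xs : Vec X n) x (i : Fin n) →
                    lookup (xs ∷ʳ x) (inject₁ i) ≡ lookup xs i
lookup-∷ʳ-inject₁ (y ∷ xs) x zero    = ≡.refl
lookup-∷ʳ-inject₁ (y ∷ xs) x (suc i) = lookup-∷ʳ-inject₁ xs x i

module _ {c ℓ} (R : CommutativeRing c ℓ) where
  open CommutativeRing R renaming (Carrier to A) hiding (zero)
  open import Algebra.Properties.Semiring.Sum semiring
    using (sum; sum-cong-≋; ∑-distrib-+; ∑-comm; sum-init-last; sum-replicate-zero;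
           *-distribˡ-sum; *-distribʳ-sum)
  open import Algebra.Properties.Group +-group using (x∙y⁻¹≈ε⇒x≈y; x≈y⇒x∙y⁻¹≈ε)
  open import Algebra.Properties.Ring ring using (-1*x≈-x; -‿involutive; -‿distribˡ-*; x[y-z]≈xy-xz)
  open import Algebra.Properties.CommutativeSemigroup *-commutativeSemigroup using (x∙yz≈y∙xz)
  open import Relation.Binary.Reasoning.Setoid setoid

  private
    infixl 7 _·_
    infixr 8 _^_

    _·_ : ∀ {n} → Matrix R n → Matrix R n → Matrix R n
    _·_ = _⊗_ R

    _^_ : ∀ {n} → Matrix R n → ℕ → Matrix R n
    _^_ = _^ᴹ_ R

    I : ∀ {n} → Matrix R n
    I = idM R

  Σ≡sum : ∀ {n} (f : Fin n → A) → Σ R f ≡ sum f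
  Σ≡sum {zero}  f = ≡.refl
  Σ≡sum {suc n} f = ≡.cong (f zero +_) (Σ≡sum (λ i → f (suc i)))

  sum-drop-last : ∀ {N} (t : Fin (suc N) → A) → t (fromℕ N) ≈ 0# → sum t ≈ sum (λ a → t (inject₁ a))
  sum-drop-last t t-last≈0 = begin
    sum t                                ≈⟨ sum-init-last t ⟩
    sum (λ a → t (inject₁ a)) + t _      ≈⟨ +-congˡ t-last≈0 ⟩
    sum (λ a → t (inject₁ a)) + 0#       ≈⟨ +-identityʳ _ ⟩
    sum (λ a → t (inject₁ a))            ∎

  x≈0⇒y*x≈0 : ∀ {x} y → x ≈ 0# → y * x ≈ 0#
  x≈0⇒y*x≈0 y x≈0 = trans (*-congˡ x≈0) (zeroʳ y)

  ⟦p⟧*⟦p⟧≈1 : ∀ p → ⟦_⟧ₚ R p * ⟦_⟧ₚ R p ≈ 1#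
  ⟦p⟧*⟦p⟧≈1 even = *-identityˡ 1#
  ⟦p⟧*⟦p⟧≈1 odd  = trans (-1*x≈-x (- 1#)) (-‿involutive 1#)

  module Twist (q : A) where
    infixl 6 _⊖_

    _⊖_ : A → A → A
    x ⊖ y = x - q * y

    ⊖≈0⇒≈ : ∀ {x y} → x ⊖ y ≈ 0# → x ≈ q * y
    ⊖≈0⇒≈ = x∙y⁻¹≈ε⇒x≈y _ _

    ≈⇒⊖≈0 : ∀ {x y} → x ≈ q * y → x ⊖ y ≈ 0#
    ≈⇒⊖≈0 = x≈y⇒x∙y⁻¹≈ε

    ⊖-cong : ∀ {x x′ y y′} → x ≈ x′ → y ≈ y′ → x ⊖ y ≈ x′ ⊖ y′
    ⊖-cong x≈x′ y≈y′ = +-cong x≈x′ (-‿cong (*-congˡ y≈y′))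

    *-distribˡ-⊖ : ∀ w x y → w * (x ⊖ y) ≈ w * x + - q * (w * y)
    *-distribˡ-⊖ w x y = begin
      w * (x ⊖ y)              ≈⟨ x[y-z]≈xy-xz w x (q * y) ⟩
      w * x - w * (q * y)      ≈⟨ +-congˡ (-‿cong (x∙yz≈y∙xz w q y)) ⟩
      w * x - q * (w * y)      ≈⟨ +-congˡ (-‿distribˡ-* q (w * y)) ⟩
      w * x + - q * (w * y)    ∎

    ∑-⊖ : ∀ {n} (w x y : Fin n → A) →
          sum (λ m → w m * (x m ⊖ y m)) ≈ sum (λ m → w m * x m) ⊖ sum (λ m → w m * y m)
    ∑-⊖ w x y = begin
      sum (λ m → w m * (x m ⊖ y m))
        ≈⟨ sum-cong-≋ (λ m → *-distribˡ-⊖ (w m) (x m) (y m)) ⟩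
      sum (λ m → w m * x m + - q * (w m * y m))
        ≈⟨ ∑-distrib-+ (λ m → w m * x m) (λ m → - q * (w m * y m)) ⟩
      sum (λ m → w m * x m) + sum (λ m → - q * (w m * y m))
        ≈⟨ +-congˡ (*-distribˡ-sum (- q) (λ m → w m * y m)) ⟨
      sum (λ m → w m * x m) + - q * sum (λ m → w m * y m)
        ≈⟨ +-congˡ (-‿distribˡ-* q _) ⟨
      sum (λ m → w m * x m) ⊖ sum (λ m → w m * y m) ∎

    ⊖-telescope : q * q ≈ 1# → ∀ a b c → (a ⊖ b) + q * (b ⊖ c) ≈ a - c
    ⊖-telescope q²≈1 a b c = begin
      (a ⊖ b) + q * (b ⊖ c)                ≈⟨ +-congˡ (x[y-z]≈xy-xz q b (q * c)) ⟩
      (a - q * b) + (q * b - q * (q * c))  ≈⟨ +-assoc a _ _ ⟩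
      a + (- (q * b) + (q * b - q * (q * c)))
        ≈⟨ +-congˡ (+-assoc _ _ _) ⟨
      a + ((- (q * b) + q * b) - q * (q * c))
        ≈⟨ +-congˡ (+-congʳ (-‿inverseˡ _)) ⟩
      a + (0# - q * (q * c))               ≈⟨ +-congˡ (+-identityˡ _) ⟩
      a - q * (q * c)                      ≈⟨ +-congˡ (-‿cong (*-assoc q q c)) ⟨
      a - (q * q) * c                      ≈⟨ +-congˡ (-‿cong (trans (*-congʳ q²≈1) (*-identityˡ c))) ⟩
      a - c                                ∎

    ⊖-cancel : q * q ≈ 1# → ∀ {a b c a′ b′ c′} →
               a ⊖ b ≈ a′ ⊖ b′ → b ⊖ c ≈ b′ ⊖ c′ → a′ ≈ c′ → a ≈ c
    ⊖-cancel q²≈1 {a} {b} {c} {a′} {b′} {c′} eq₁ eq₂ a′≈c′ = x∙y⁻¹≈ε⇒x≈y a c (begin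
      a - c                        ≈⟨ ⊖-telescope q²≈1 a b c ⟨
      (a ⊖ b) + q * (b ⊖ c)        ≈⟨ +-cong eq₁ (*-congˡ eq₂) ⟩
      (a′ ⊖ b′) + q * (b′ ⊖ c′)    ≈⟨ ⊖-telescope q²≈1 a′ b′ c′ ⟩
      a′ - c′                      ≈⟨ x≈y⇒x∙y⁻¹≈ε a′≈c′ ⟩
      0#                           ∎)

  ·-entry : ∀ {n} (X Y : Matrix R n) i j → (X · Y) i j ≈ sum (λ l → X i l * Y l j)
  ·-entry X Y i j = reflexive (Σ≡sum (λ l → X i l * Y l j))

  ·-assoc : ∀ {n} (X Y Z : Matrix R n) i j → ((X · Y) · Z) i j ≈ (X · (Y · Z)) i j
  ·-assoc X Y Z i j = begin
    ((X · Y) · Z) i j                              ≈⟨ ·-entry (X · Y) Z i j ⟩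
    sum (λ k → (X · Y) i k * Z k j)                ≈⟨ sum-cong-≋ (λ k → *-congʳ (·-entry X Y i k)) ⟩
    sum (λ k → sum (λ l → X i l * Y l k) * Z k j)  ≈⟨ sum-cong-≋ (λ k → *-distribʳ-sum (Z k j) (λ l → X i l * Y l k)) ⟩
    sum (λ k → sum (λ l → X i l * Y l k * Z k j))  ≈⟨ ∑-comm (λ k l → X i l * Y l k * Z k j) ⟩
    sum (λ l → sum (λ k → X i l * Y l k * Z k j))  ≈⟨ sum-cong-≋ (λ l → sum-cong-≋ (λ k → *-assoc (X i l) (Y l k) (Z k j))) ⟩
    sum (λ l → sum (λ k → X i l * (Y l k * Z k j)))
      ≈⟨ sum-cong-≋ (λ l → *-distribˡ-sum (X i l) (λ k → Y l k * Z k j)) ⟨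
    sum (λ l → X i l * sum (λ k → Y l k * Z k j))  ≈⟨ sum-cong-≋ (λ l → *-congˡ (·-entry Y Z l j)) ⟨
    sum (λ l → X i l * (Y · Z) l j)                ≈⟨ ·-entry X (Y · Z) i j ⟨
    (X · (Y · Z)) i j                              ∎

  ·-congˡ : ∀ {n} (X : Matrix R n) {Y Y′ : Matrix R n} → (∀ l j → Y l j ≈ Y′ l j) →
            ∀ i j → (X · Y) i j ≈ (X · Y′) i j
  ·-congˡ X {Y} {Y′} Y≈Y′ i j = begin
    (X · Y) i j                  ≈⟨ ·-entry X Y i j ⟩
    sum (λ l → X i l * Y l j)    ≈⟨ sum-cong-≋ (λ l → *-congˡ (Y≈Y′ l j)) ⟩
    sum (λ l → X i l * Y′ l j)   ≈⟨ ·-entry X Y′ i j ⟨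
    (X · Y′) i j                 ∎

  idM-symmetric : ∀ {n} → Symmetric R (I {n})
  idM-symmetric zero    zero    = refl
  idM-symmetric zero    (suc j) = refl
  idM-symmetric (suc i) zero    = refl
  idM-symmetric (suc i) (suc j) = idM-symmetric i j

  ∑-idMˡ : ∀ {n} (x : Fin n → A) i → sum (λ l → I i l * x l) ≈ x i
  ∑-idMˡ {suc n} x zero = begin
    1# * x zero + sum (λ l → 0# * x (suc l))  ≈⟨ +-cong (*-identityˡ _) (sum-cong-≋ (λ l → zeroˡ (x (suc l)))) ⟩
    x zero + sum {n} (λ _ → 0#)               ≈⟨ +-congˡ (sum-replicate-zero n) ⟩
    x zero + 0#                               ≈⟨ +-identityʳ _ ⟩
    x zero                                    ∎
  ∑-idMˡ {suc n} x (suc i) = trans (+-cong (zeroˡ _) (∑-idMˡ (λ l → x (suc l)) i)) (+-identityˡ _)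

  ∑-idMʳ : ∀ {n} (x : Fin n → A) j → sum (λ l → x l * I l j) ≈ x j
  ∑-idMʳ x j = trans (sum-cong-≋ (λ l → trans (*-comm (x l) (I l j)) (*-congʳ (idM-symmetric l j)))) (∑-idMˡ x j)

  ^-·-comm : ∀ {n} (X : Matrix R n) k i j → (X ^ k · X) i j ≈ (X · X ^ k) i j
  ^-·-comm X zero i j = begin
    (I · X) i j                  ≈⟨ ·-entry I X i j ⟩
    sum (λ l → I i l * X l j)    ≈⟨ ∑-idMˡ (λ l → X l j) i ⟩
    X i j                        ≈⟨ ∑-idMʳ (X i) j ⟨
    sum (λ l → X i l * I l j)    ≈⟨ ·-entry X I i j ⟨
    (X · I) i j                  ∎
  ^-·-comm X (suc k) i j = trans (·-assoc X (X ^ k) X i j) (·-congˡ X (^-·-comm X k) i j)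

  ^-symmetric : ∀ {n} {X : Matrix R n} → Symmetric R X → ∀ k → Symmetric R (X ^ k)
  ^-symmetric X-sym zero    = idM-symmetric
  ^-symmetric {X = X} X-sym (suc k) i j = begin
    (X · X ^ k) i j                  ≈⟨ ·-entry X (X ^ k) i j ⟩
    sum (λ l → X i l * (X ^ k) l j)  ≈⟨ sum-cong-≋ (λ l → *-comm (X i l) ((X ^ k) l j)) ⟩
    sum (λ l → (X ^ k) l j * X i l)  ≈⟨ sum-cong-≋ (λ l → *-cong (^-symmetric X-sym k l j) (X-sym i l)) ⟩
    sum (λ l → (X ^ k) j l * X l i)  ≈⟨ ·-entry (X ^ k) X j i ⟨
    (X ^ k · X) j i                  ≈⟨ ^-·-comm X k j i ⟩
    (X · X ^ k) j i                  ∎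

  idM-inject₁ : ∀ {N} (a b : Fin N) → I (inject₁ a) (inject₁ b) ≡ I a b
  idM-inject₁ zero    zero    = ≡.refl
  idM-inject₁ zero    (suc b) = ≡.refl
  idM-inject₁ (suc a) zero    = ≡.refl
  idM-inject₁ (suc a) (suc b) = idM-inject₁ a b

  idM-fromℕ-inject₁ : ∀ {N} (b : Fin N) → I (fromℕ N) (inject₁ b) ≡ 0#
  idM-fromℕ-inject₁ zero    = ≡.refl
  idM-fromℕ-inject₁ (suc b) = idM-fromℕ-inject₁ b

  weightVec-lift-inject₁ : ∀ {N} (Q : Subset N) (ε : Fin N → A) a →
    weightVec R (liftSubset R Q) (liftWeights R ε) (inject₁ a) ≡ weightVec R Q ε a
  weightVec-lift-inject₁ Q ε a rewrite lookup-∷ʳ-inject₁ Q false a with lookup Q a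
  ... | true  rewrite classify-inject₁ a = ≡.refl
  ... | false = ≡.refl

  module Walks (p : Parity) where
    open Twist (⟦_⟧ₚ R p) public

    -- δ X u v is the column X (e_u − p e_v).
    δ : ∀ {n} → Matrix R n → Fin n → Fin n → Fin n → A
    δ X u v i = X i u ⊖ X i v

    δ-· : ∀ {n} (X Y : Matrix R n) u v i → δ (X · Y) u v i ≈ sum (λ l → X i l * δ Y u v l)
    δ-· X Y u v i = begin
      (X · Y) i u ⊖ (X · Y) i v
        ≈⟨ ⊖-cong (·-entry X Y i u) (·-entry X Y i v) ⟩
      sum (λ l → X i l * Y l u) ⊖ sum (λ l → X i l * Y l v)
        ≈⟨ ∑-⊖ (X i) (λ l → Y l u) (λ l → Y l v) ⟨
      sum (λ l → X i l * δ Y u v l) ∎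

    ∑-δ-^ : ∀ {n} {H : Matrix R n} → Symmetric R H → ∀ (w : Fin n → A) u v k →
            sum (λ m → w m * δ (H ^ k) u v m)
            ≈ Σ R (λ m → w m * (H ^ k) u m) ⊖ Σ R (λ m → w m * (H ^ k) v m)
    ∑-δ-^ {H = H} H-sym w u v k = begin
      sum (λ m → w m * δ (H ^ k) u v m)
        ≈⟨ ∑-⊖ w (λ m → (H ^ k) m u) (λ m → (H ^ k) m v) ⟩
      sum (λ m → w m * (H ^ k) m u) ⊖ sum (λ m → w m * (H ^ k) m v)
        ≈⟨ ⊖-cong (sum-cong-≋ (λ m → *-congˡ (Hᵏ-sym m u))) (sum-cong-≋ (λ m → *-congˡ (Hᵏ-sym m v))) ⟩
      sum (λ m → w m * (H ^ k) u m) ⊖ sum (λ m → w m * (H ^ k) v m)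
        ≈⟨ ⊖-cong (reflexive (Σ≡sum (λ m → w m * (H ^ k) u m)))
                  (reflexive (Σ≡sum (λ m → w m * (H ^ k) v m))) ⟨
      Σ R (λ m → w m * (H ^ k) u m) ⊖ Σ R (λ m → w m * (H ^ k) v m) ∎
      where
      Hᵏ-sym : Symmetric R (H ^ k)
      Hᵏ-sym = ^-symmetric H-sym k

    multiplet⇒∑-δ≈0 : ∀ {n} {H : Matrix R n} {u v Q ε} → Symmetric R H → WalkMultiplet R H u v Q ε p →
                       ∀ k → sum (λ m → weightVec R Q ε m * δ (H ^ k) u v m) ≈ 0#
    multiplet⇒∑-δ≈0 {u = u} {v} {Q} {ε} H-sym multiplet k =
      trans (∑-δ-^ H-sym (weightVec R Q ε) u v k) (≈⇒⊖≈0 (multiplet k))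

    ∑-δ≈0⇒multiplet : ∀ {n} {H : Matrix R n} {u v Q ε} → Symmetric R H →
                       (∀ k → sum (λ m → weightVec R Q ε m * δ (H ^ k) u v m) ≈ 0#) →
                       WalkMultiplet R H u v Q ε p
    ∑-δ≈0⇒multiplet {u = u} {v} {Q} {ε} H-sym ∑-δ≈0 k =
      ⊖≈0⇒≈ (trans (sym (∑-δ-^ H-sym (weightVec R Q ε) u v k)) (∑-δ≈0 k))

    δ≈0⇒singlet : ∀ {n} {H : Matrix R n} {u v c} → Symmetric R H →
                  (∀ k → δ (H ^ k) u v c ≈ 0#) → WalkSinglet R H u v c p
    δ≈0⇒singlet {H = H} {u} {v} {c} H-sym δ≈0 k = begin
      (H ^ k) u c                ≈⟨ ^-symmetric H-sym k u c ⟩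
      (H ^ k) c u                ≈⟨ ⊖≈0⇒≈ (δ≈0 k) ⟩
      ⟦_⟧ₚ R p * (H ^ k) c v     ≈⟨ *-congˡ (^-symmetric H-sym k c v) ⟩
      ⟦_⟧ₚ R p * (H ^ k) v c     ∎

  module Cone {N} (G : Matrix R N) (M : Subset N) (γ : Fin N → A) where
    private
      H : Matrix R (suc N)
      H = cone R G M γ

    cone-inject₁ : ∀ a b → H (inject₁ a) (inject₁ b) ≡ G a b
    cone-inject₁ a b rewrite classify-inject₁ a | classify-inject₁ b = ≡.refl

    cone-fromℕ-inject₁ : ∀ b → H (fromℕ N) (inject₁ b) ≡ weightVec R M γ b
    cone-fromℕ-inject₁ b rewrite classify-fromℕ N | classify-inject₁ b = ≡.refl

    cone-symmetric : Symmetric R G → Symmetric R H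
    cone-symmetric G-sym i j with classify i | classify j
    ... | just a  | just b  = G-sym a b
    ... | just a  | nothing = refl
    ... | nothing | just b  = refl
    ... | nothing | nothing = refl

  module ConeWalks {N} (G : Matrix R N) (M : Subset N) (γ : Fin N → A) (p : Parity) (u v : Fin N)
                   (G-sym : Symmetric R G) (multiplet : WalkMultiplet R G u v M γ p) where
    open Walks p
    open Cone G M γ

    private
      H : Matrix R (suc N)
      H = cone R G M γ

      H-sym : Symmetric R H
      H-sym = cone-symmetric G-sym

      u′ v′ tip : Fin (suc N)
      u′  = inject₁ u
      v′  = inject₁ v
      tip = fromℕ N

    cone-δ-suc : ∀ k → δ (H ^ k) u′ v′ tip ≈ 0# →
           (∀ a → δ (H ^ k) u′ v′ (inject₁ a) ≈ δ (G ^ k) u v a) →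
           ∀ i → δ (H ^ suc k) u′ v′ i ≈ sum (λ a → H i (inject₁ a) * δ (G ^ k) u v a)
    cone-δ-suc k tip≈0 old≈ i = begin
      δ (H ^ suc k) u′ v′ i
        ≈⟨ δ-· H (H ^ k) u′ v′ i ⟩
      sum (λ l → H i l * δ (H ^ k) u′ v′ l)
        ≈⟨ sum-drop-last (λ l → H i l * δ (H ^ k) u′ v′ l) (x≈0⇒y*x≈0 (H i tip) tip≈0) ⟩
      sum (λ a → H i (inject₁ a) * δ (H ^ k) u′ v′ (inject₁ a))
        ≈⟨ sum-cong-≋ (λ a → *-congˡ (old≈ a)) ⟩
      sum (λ a → H i (inject₁ a) * δ (G ^ k) u v a) ∎

    cone-δ : ∀ k → δ (H ^ k) u′ v′ tip ≈ 0#
                 × (∀ a → δ (H ^ k) u′ v′ (inject₁ a) ≈ δ (G ^ k) u v a)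
    cone-δ zero = tip≈0 , old≈
      where
      tip≈0 : δ I u′ v′ tip ≈ 0#
      tip≈0 = trans (⊖-cong (reflexive (idM-fromℕ-inject₁ u)) (reflexive (idM-fromℕ-inject₁ v)))
                    (≈⇒⊖≈0 (sym (zeroʳ _)))
      old≈ : ∀ a → δ I u′ v′ (inject₁ a) ≈ δ I u v a
      old≈ a = ⊖-cong (reflexive (idM-inject₁ a u)) (reflexive (idM-inject₁ a v))
    cone-δ (suc k) = tip≈0 , old≈
      where
      tip≈0 : δ (H ^ suc k) u′ v′ tip ≈ 0#
      tip≈0 = begin
        δ (H ^ suc k) u′ v′ tip                             ≈⟨ cone-δ-suc k (proj₁ (cone-δ k)) (proj₂ (cone-δ k)) tip ⟩
        sum (λ a → H tip (inject₁ a) * δ (G ^ k) u v a)     ≈⟨ sum-cong-≋ (λ a → *-congʳ (reflexive (cone-fromℕ-inject₁ a))) ⟩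
        sum (λ a → weightVec R M γ a * δ (G ^ k) u v a)     ≈⟨ multiplet⇒∑-δ≈0 {Q = M} {γ} G-sym multiplet k ⟩
        0#                                                  ∎
      old≈ : ∀ b → δ (H ^ suc k) u′ v′ (inject₁ b) ≈ δ (G ^ suc k) u v b
      old≈ b = begin
        δ (H ^ suc k) u′ v′ (inject₁ b)                     ≈⟨ cone-δ-suc k (proj₁ (cone-δ k)) (proj₂ (cone-δ k)) (inject₁ b) ⟩
        sum (λ a → H (inject₁ b) (inject₁ a) * δ (G ^ k) u v a) ≈⟨ sum-cong-≋ (λ a → *-congʳ (reflexive (cone-inject₁ b a))) ⟩
        sum (λ a → G b a * δ (G ^ k) u v a)                 ≈⟨ δ-· G (G ^ k) u v b ⟨
        δ (G ^ suc k) u v b                                 ∎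

    cone-cospectral : Cospectral R G u v → Cospectral R H u′ v′
    cone-cospectral G-cospectral k =
      ⊖-cancel (⟦p⟧*⟦p⟧≈1 p) (old≈ u)
        (trans (⊖-cong (^-symmetric H-sym k u′ v′) refl)
               (trans (old≈ v) (⊖-cong (^-symmetric G-sym k v u) refl)))
        (G-cospectral k)
      where
      old≈ : ∀ a → δ (H ^ k) u′ v′ (inject₁ a) ≈ δ (G ^ k) u v a
      old≈ = proj₂ (cone-δ k)

    cone-tip-singlet : WalkSinglet R H u′ v′ tip p
    cone-tip-singlet = δ≈0⇒singlet H-sym (λ k → proj₁ (cone-δ k))

    cone-multiplet : ∀ (Q : Subset N) (ε : Fin N → A) → WalkMultiplet R G u v Q ε p →
                     WalkMultiplet R H u′ v′ (liftSubset R Q) (liftWeights R ε) p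
    cone-multiplet Q ε Q-multiplet = ∑-δ≈0⇒multiplet {Q = liftSubset R Q} {liftWeights R ε} H-sym λ k → begin
      sum (λ m → w m * δ (H ^ k) u′ v′ m)
        ≈⟨ sum-drop-last (λ m → w m * δ (H ^ k) u′ v′ m) (x≈0⇒y*x≈0 (w tip) (proj₁ (cone-δ k))) ⟩
      sum (λ a → w (inject₁ a) * δ (H ^ k) u′ v′ (inject₁ a))
        ≈⟨ sum-cong-≋ (λ a → *-cong (reflexive (weightVec-lift-inject₁ Q ε a)) (proj₂ (cone-δ k) a)) ⟩
      sum (λ a → weightVec R Q ε a * δ (G ^ k) u v a)
        ≈⟨ multiplet⇒∑-δ≈0 {Q = Q} {ε} G-sym Q-multiplet k ⟩
      0# ∎
      where
      w : Fin (suc N) → A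
      w = weightVec R (liftSubset R Q) (liftWeights R ε)

theorem1 : ∀ {c ℓ} (R : CommutativeRing c ℓ) (N : ℕ) (G : Matrix R N) (u v : Fin N)
    (M : Subset N) (γ : Fin N → CommutativeRing.Carrier R) (p : Parity) →
    Symmetric R G →
    Cospectral R G u v →
    WalkMultiplet R G u v M γ p →
    Cospectral R (cone R G M γ) (inject₁ u) (inject₁ v)
    × WalkSinglet R (cone R G M γ) (inject₁ u) (inject₁ v) (fromℕ N) p
    × (∀ (Q : Subset N) (ε : Fin N → CommutativeRing.Carrier R) →
         WalkMultiplet R G u v Q ε p →
         WalkMultiplet R (cone R G M γ) (inject₁ u) (inject₁ v) (liftSubset R Q) (liftWeights R ε) p)
theorem1 R N G u v M γ p G-sym G-cospectral multiplet =
  cone-cospectral G-cospectral , cone-tip-singlet , cone-multiplet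
  where open ConeWalks R G M γ p u v G-sym multiplet
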